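{- Let $w$ be a word of length $n$ and $1\le i\le n$ with $\mathsf{LSF}_\ell[i]>0$, and let $j=\mathsf{LSF}_r[i]$. If $\mathsf{LSF}_\ell[i]<\mathsf{LUF}[j]$, then $\mathsf{LUF}[i]=j+\mathsf{LUF}[j]-i$.
   Context: For a word $w=w[1]\cdots w[n]$, $w[i\mathinner{.\,.} j]$ denotes the factor $w[i]\cdots w[j]$. A border of a word $x$ is a (possibly empty) word $u\neq x$ that is both a prefix and a suffix of $x$; $x$ is unbordered if its only border is the empty word. $\mathsf{LUF}[i]$ is the length of the longest unbordered prefix of $w[i\mathinner{.\,.} n]$. The longest successor factor array is defined by $\mathsf{LSF}_\ell[n]=0$ and, for $i<n$, $\mathsf{LSF}_\ell[i]=\max\{k\ge 0 : w[i\mathinner{.\,.} i+k-1]=w[j\mathinner{.\,.} j+k-1]\text{ for some } j \text{ with } i<j\le n\}$. The reference array: if $\mathsf{LSF}_\ell[i]=0$ then $\mathsf{LSF}_r[i]$ is undefined (nil); otherwise $\mathsf{LSF}_r[i]=\max\{j : i<j\le n,\ w[j\mathinner{.\,.} j+\mathsf{LSF}_\ell[i]-1]=w[i\mathinner{.\,.} i+\mathsf{LSF}_\ell[i]-1]\}$, the position of the last occurrence of that factor. -}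

module Defs where

open import Data.Nat using (ℕ; zero; suc; _+_; _∸_; _≤_; _<_)
open import Data.List using (List; []; _++_; length; take; drop)
open import Data.Product using (Σ; ∃; _×_; _,_)
open import Data.Sum using (_⊎_)
open import Relation.Binary.PropositionalEquality using (_≡_; _≢_)

-- Words are lists; positions are 1-based as in the paper.

IsPrefix : {A : Set} → List A → List A → Set
IsPrefix u x = ∃ λ v → u ++ v ≡ x

IsSuffix : {A : Set} → List A → List A → Set
IsSuffix u x = ∃ λ v → v ++ u ≡ x

IsBorder : {A : Set} → List A → List A → Set
IsBorder u x = (u ≢ x) × IsPrefix u x × IsSuffix u x

Unbordered : {A : Set} → List A → Set
Unbordered x = ∀ u → IsBorder u x → u ≡ []

suf : {A : Set} → List A → ℕ → List A
suf w i = drop (i ∸ 1) w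

fac : {A : Set} → List A → ℕ → ℕ → List A
fac w i k = take k (suf w i)

SameFactor : {A : Set} → List A → ℕ → ℕ → ℕ → Set
SameFactor w i j k = (i + k ≤ suc (length w)) × (j + k ≤ suc (length w)) × (fac w i k ≡ fac w j k)

IsLUF : {A : Set} → List A → ℕ → ℕ → Set
IsLUF w i m =
  (∃ λ p → IsPrefix p (suf w i) × Unbordered p × length p ≡ m)
  × (∀ p → IsPrefix p (suf w i) → Unbordered p → length p ≤ m)

LSFWitness : {A : Set} → List A → ℕ → ℕ → Set
LSFWitness w i k = ∃ λ j → (i < j) × (j ≤ length w) × SameFactor w i j k

IsLSFℓ : {A : Set} → List A → ℕ → ℕ → Set
IsLSFℓ w i k =
  ((i ≡ length w) × (k ≡ 0))
  ⊎ ((i < length w) × LSFWitness w i k × (∀ k' → LSFWitness w i k' → k' ≤ k))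

IsLSFr : {A : Set} → List A → ℕ → ℕ → ℕ → Set
IsLSFr w i k j =
  (i < j) × (j ≤ length w) × SameFactor w i j k
  × (∀ j' → i < j' → j' ≤ length w → SameFactor w i j' k → j' ≤ j)

-- Write s = w[i..n] = a t with |a| = j - i, so that t = w[j..n], and let f be the prefix of s
-- of length k = LSF_ℓ[i], which is also a prefix of t.  Borders of length at most k are prefixes
-- of f, so they can be moved between s and t.  If y is the longest unbordered prefix of t, then
-- a y is unbordered: a border of length ≤ k would be a border of y, a longer one a prefix of s
-- recurring later in s, contradicting the maximality of k.  Conversely, if a z is an unbordered
-- prefix of s then z is unbordered: a border of length ≤ k would be a border of a z, a longer
-- one would start with an occurrence of f after position j, contradicting the choice of j.
module Submission where

open import Defs
open import Data.Nat using (ℕ; suc; _+_; _∸_; _≤_; _<_; z≤n; s≤s; _≤?_)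
open import Data.Nat.Properties
open import Data.List using (List; []; _∷_; _++_; length; take; drop; reverse)
open import Data.List.Properties
  using (++-assoc; ++-cancelˡ; ++-conicalˡ; ∷-injective; length-++; length-++-≤ˡ; length-++-≤ʳ;
         length-take; length-drop; take++drop≡id; drop-drop; reverse-++; reverse-involutive;
         length-reverse)
open import Data.Product using (∃; _×_; _,_)
open import Data.Sum using (inj₁; inj₂)
open import Relation.Nullary using (yes; no; contradiction)
open import Relation.Binary.PropositionalEquality

module _ {A : Set} where

  length-nonempty : {c : List A} → c ≢ [] → 0 < length c
  length-nonempty {[]}    c≢[] = contradiction refl c≢[]
  length-nonempty {_ ∷ _} _    = s≤s z≤n

  length-pos⇒≢[] : {c : List A} → 0 < length c → c ≢ []
  length-pos⇒≢[] () refl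

  length-++-< : (c : List A) {d : List A} → d ≢ [] → length c < length (c ++ d)
  length-++-< c {d} d≢[] =
    subst (length c <_) (sym (length-++ c)) (m<m+n (length c) (length-nonempty d≢[]))

  length-take≤ : {k : ℕ} {xs : List A} → k ≤ length xs → length (take k xs) ≡ k
  length-take≤ {k} {xs} k≤ = trans (length-take k xs) (m≤n⇒m⊓n≡m k≤)

  take-length-++ : (x : List A) {y : List A} → take (length x) (x ++ y) ≡ x
  take-length-++ []      = refl
  take-length-++ (a ∷ x) = cong (a ∷_) (take-length-++ x)

  drop-length-++ : (x : List A) {y : List A} → drop (length x) (x ++ y) ≡ y
  drop-length-++ []      = refl
  drop-length-++ (_ ∷ x) = drop-length-++ x

  take-prefix : (k : ℕ) (xs : List A) → IsPrefix (take k xs) xs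
  take-prefix k xs = drop k xs , take++drop≡id k xs

  prefix-trans : {a b c : List A} → IsPrefix a b → IsPrefix b c → IsPrefix a c
  prefix-trans {a} (v , refl) (v′ , refl) = v ++ v′ , sym (++-assoc a v v′)

  suffix-trans : {a b c : List A} → IsSuffix a b → IsSuffix b c → IsSuffix a c
  suffix-trans {a} (v , refl) (v′ , refl) = v′ ++ v , ++-assoc v′ v a

  prefix-length : {a b : List A} → IsPrefix a b → length a ≤ length b
  prefix-length {a} (_ , refl) = length-++-≤ˡ a

  prefix-++⁺ : (a : List A) {y t : List A} → IsPrefix y t → IsPrefix (a ++ y) (a ++ t)
  prefix-++⁺ a {y} (r , refl) = r , ++-assoc a y r

  prefix-++⁻ : (a : List A) {z t : List A} → IsPrefix (a ++ z) (a ++ t) → IsPrefix z t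
  prefix-++⁻ a {z} (r , eq) = r , ++-cancelˡ a _ _ (trans (sym (++-assoc a z r)) eq)

  prefix-of-prefix : {a b x : List A} → IsPrefix a x → IsPrefix b x →
    length a ≤ length b → IsPrefix a b
  prefix-of-prefix {[]}    {b}     _         _        _        = b , refl
  prefix-of-prefix {_ ∷ _} {[]}    _         _        ()
  prefix-of-prefix {_ ∷ a} {_ ∷ b} (v , refl) (v′ , eq) (s≤s le) with ∷-injective eq
  ... | refl , eq′ with prefix-of-prefix {a} {b} (v , refl) (v′ , eq′) le
  ... | q , refl = q , refl

  suffix⇒prefix-reverse : {a x : List A} → IsSuffix a x → IsPrefix (reverse a) (reverse x)
  suffix⇒prefix-reverse {a} (v , refl) = reverse v , sym (reverse-++ v a)

  prefix-reverse⇒suffix : {a x : List A} → IsPrefix (reverse a) (reverse x) → IsSuffix a x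
  prefix-reverse⇒suffix {a} {x} (r , eq) = reverse r , (begin
    reverse r ++ a                     ≡⟨ cong (reverse r ++_) (sym (reverse-involutive a)) ⟩
    reverse r ++ reverse (reverse a)   ≡⟨ sym (reverse-++ (reverse a) r) ⟩
    reverse (reverse a ++ r)           ≡⟨ cong reverse eq ⟩
    reverse (reverse x)                ≡⟨ reverse-involutive x ⟩
    x                                  ∎)
    where open ≡-Reasoning

  suffix-of-suffix : {a b x : List A} → IsSuffix a x → IsSuffix b x →
    length a ≤ length b → IsSuffix a b
  suffix-of-suffix {a} {b} a⊒x b⊒x le = prefix-reverse⇒suffix
    (prefix-of-prefix (suffix⇒prefix-reverse a⊒x) (suffix⇒prefix-reverse b⊒x)
      (subst₂ _≤_ (sym (length-reverse a)) (sym (length-reverse b)) le))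

  border-length : {b x : List A} → IsBorder b x → length b < length x
  border-length     (b≢x , _ , []    , eq)   = contradiction eq b≢x
  border-length {b} (_   , _ , _ ∷ v , refl) = s≤s (length-++-≤ʳ b {v})

  border-offset : {b x : List A} → IsBorder b x → ∃ λ c → c ≢ [] × c ++ b ≡ x
  border-offset (b≢x , _ , []    , eq) = contradiction eq b≢x
  border-offset (_   , _ , a ∷ c , eq) = a ∷ c , (λ ()) , eq

  mkBorder : {b x : List A} → IsPrefix b x → IsSuffix b x → length b < length x → IsBorder b x
  mkBorder b⊑x b⊒x b<x = (λ { refl → <-irrefl refl b<x }) , b⊑x , b⊒x

  -- Offsets are 0-based: an occurrence of b in s at offset |c| is a factorisation s = c b r.
  NoRecurringPrefixLongerThan : ℕ → List A → Set
  NoRecurringPrefixLongerThan k s =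
    ∀ c b r → c ≢ [] → IsPrefix b s → c ++ b ++ r ≡ s → length b ≤ k

  NoOccurrenceAfter : ℕ → List A → List A → Set
  NoOccurrenceAfter d f s = ∀ c r → c ++ f ++ r ≡ s → length c ≤ d

  unbordered-++⁺ : {a t y f : List A} → IsPrefix f (a ++ t) → IsPrefix f t →
    NoRecurringPrefixLongerThan (length f) (a ++ t) →
    IsPrefix y t → length f < length y → Unbordered y → Unbordered (a ++ y)
  unbordered-++⁺ {a} {_} {y} {f} f⊑s f⊑t noRec y⊑t@(r , refl) f<y unb-y
                 b b-border@(_ , b⊑ay , b⊒ay) with length b ≤? length f
  ... | yes b≤f = unb-y b (mkBorder b⊑y b⊒y (≤-<-trans b≤f f<y))
    where
    b≤y : length b ≤ length y
    b≤y = ≤-trans b≤f (<⇒≤ f<y)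
    b⊑t : IsPrefix b (y ++ r)
    b⊑t = prefix-trans (prefix-of-prefix (prefix-trans b⊑ay (prefix-++⁺ a y⊑t)) f⊑s b≤f) f⊑t
    b⊑y : IsPrefix b y
    b⊑y = prefix-of-prefix b⊑t y⊑t b≤y
    b⊒y : IsSuffix b y
    b⊒y = suffix-of-suffix b⊒ay (a , refl) b≤y
  ... | no b≰f with border-offset b-border
  ...   | c , c≢[] , cb≡ay =
    contradiction (noRec c b r c≢[] (prefix-trans b⊑ay (prefix-++⁺ a y⊑t)) occ) b≰f
    where
    open ≡-Reasoning
    occ : c ++ b ++ r ≡ a ++ y ++ r
    occ = begin
      c ++ b ++ r   ≡⟨ sym (++-assoc c b r) ⟩
      (c ++ b) ++ r ≡⟨ cong (_++ r) cb≡ay ⟩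
      (a ++ y) ++ r ≡⟨ ++-assoc a y r ⟩
      a ++ y ++ r   ∎

  unbordered-++⁻ : {a t z f : List A} → IsPrefix f (a ++ t) → IsPrefix f t →
    NoOccurrenceAfter (length a) f (a ++ t) →
    IsPrefix z t → Unbordered (a ++ z) → Unbordered z
  unbordered-++⁻ {a} {_} {z} {f} f⊑s f⊑t noOcc z⊑t@(r , refl) unb-az
                 b b-border@(_ , b⊑z , b⊒z) with length b ≤? length f
  ... | yes b≤f = unb-az b (mkBorder b⊑az (suffix-trans b⊒z (a , refl)) b<az)
    where
    b<az : length b < length (a ++ z)
    b<az = <-≤-trans (border-length b-border) (length-++-≤ʳ z {a})
    b⊑f : IsPrefix b f
    b⊑f = prefix-of-prefix (prefix-trans b⊑z z⊑t) f⊑t b≤f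
    b⊑az : IsPrefix b (a ++ z)
    b⊑az = prefix-of-prefix (prefix-trans b⊑f f⊑s) (prefix-++⁺ a z⊑t) (<⇒≤ b<az)
  ... | no b≰f with border-offset b-border
        | prefix-of-prefix f⊑t (prefix-trans b⊑z z⊑t) (<⇒≤ (≰⇒> b≰f))
  ...   | c , c≢[] , refl | q , refl =
    contradiction (noOcc (a ++ c) (q ++ r) occ) (<⇒≱ (length-++-< a c≢[]))
    where
    open ≡-Reasoning
    occ : (a ++ c) ++ f ++ q ++ r ≡ a ++ (c ++ f ++ q) ++ r
    occ = begin
      (a ++ c) ++ f ++ q ++ r   ≡⟨ ++-assoc a c (f ++ q ++ r) ⟩
      a ++ c ++ f ++ q ++ r     ≡⟨ cong (λ x → a ++ c ++ x) (sym (++-assoc f q r)) ⟩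
      a ++ c ++ (f ++ q) ++ r   ≡⟨ cong (a ++_) (sym (++-assoc c (f ++ q) r)) ⟩
      a ++ (c ++ f ++ q) ++ r   ∎

  LongestUnborderedPrefix : List A → ℕ → Set
  LongestUnborderedPrefix t m =
    (∃ λ p → IsPrefix p t × Unbordered p × length p ≡ m)
    × (∀ p → IsPrefix p t → Unbordered p → length p ≤ m)

  longestUnborderedPrefix-unique : {t : List A} {m m′ : ℕ} →
    LongestUnborderedPrefix t m → LongestUnborderedPrefix t m′ → m ≡ m′
  longestUnborderedPrefix-unique ((p , p⊑t , unb-p , refl) , max)
                                 ((p′ , p′⊑t , unb-p′ , refl) , max′) =
    ≤-antisym (max′ p p⊑t unb-p) (max p′ p′⊑t unb-p′)

  longestUnborderedPrefix-++ : {a t s f : List A} {u : ℕ} → a ++ t ≡ s →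
    IsPrefix f s → IsPrefix f t →
    NoRecurringPrefixLongerThan (length f) s → NoOccurrenceAfter (length a) f s →
    length f < u → LongestUnborderedPrefix t u → LongestUnborderedPrefix s (length a + u)
  longestUnborderedPrefix-++ {a} {t} refl f⊑s f⊑t noRec noOcc f<u
                             ((y , y⊑t , unb-y , refl) , max-t) =
    (a ++ y , prefix-++⁺ a y⊑t , unbordered-++⁺ f⊑s f⊑t noRec y⊑t f<u unb-y , length-++ a) ,
    max-s
    where
    max-s : ∀ p → IsPrefix p (a ++ t) → Unbordered p → length p ≤ length a + length y
    max-s p p⊑s unb-p with length a ≤? length p
    ... | no a≰p = ≤-trans (<⇒≤ (≰⇒> a≰p)) (m≤m+n (length a) (length y))
    ... | yes a≤p with prefix-of-prefix (t , refl) p⊑s a≤p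
    ...   | z , refl = subst (_≤ length a + length y) (sym (length-++ a))
      (+-monoʳ-≤ (length a) (max-t z z⊑t (unbordered-++⁻ f⊑s f⊑t noOcc z⊑t unb-p)))
      where
      z⊑t : IsPrefix z t
      z⊑t = prefix-++⁻ a p⊑s

  suf-+ : (w : List A) (i₀ e : ℕ) → suf w (suc i₀ + e) ≡ drop e (suf w (suc i₀))
  suf-+ w i₀ e = sym (drop-drop i₀ e w)

  -- The 1-based position i is written suc i₀, so that suf w i = drop i₀ w.
  module _ (w : List A) {i₀ : ℕ} (i≤n : suc i₀ ≤ length w) where

    length-suf : i₀ + length (suf w (suc i₀)) ≡ length w
    length-suf = trans (cong (i₀ +_) (length-drop i₀ w)) (m+[n∸m]≡n (<⇒≤ i≤n))

    inside-suf⇒inside-w : {m : ℕ} → m ≤ length (suf w (suc i₀)) → i₀ + m ≤ length w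
    inside-suf⇒inside-w m≤ = ≤-trans (+-monoʳ-≤ i₀ m≤) (≤-reflexive length-suf)

    inside-w⇒inside-suf : {m : ℕ} → i₀ + m ≤ length w → m ≤ length (suf w (suc i₀))
    inside-w⇒inside-suf {m} le = +-cancelˡ-≤ i₀ _ _ (subst (i₀ + m ≤_) (sym length-suf) le)

    occurrence-start : {c b r : List A} → b ≢ [] → c ++ b ++ r ≡ suf w (suc i₀) →
      suc i₀ + length c ≤ length w
    occurrence-start {c} {b} {r} b≢[] eq = subst (_≤ length w) (+-suc i₀ (length c))
      (inside-suf⇒inside-w (subst (length c <_) (cong length eq)
        (length-++-< c (λ br≡[] → b≢[] (++-conicalˡ b r br≡[])))))

    occurrence⇒SameFactor : {c b r : List A} → IsPrefix b (suf w (suc i₀)) →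
      c ++ b ++ r ≡ suf w (suc i₀) → SameFactor w (suc i₀) (suc i₀ + length c) (length b)
    occurrence⇒SameFactor {c} {b} {r} b⊑s@(v , bv≡s) eq =
      s≤s (inside-suf⇒inside-w (prefix-length b⊑s)) , s≤s end-bound , same-factor
      where
      s = suf w (suc i₀)
      end-bound : i₀ + length c + length b ≤ length w
      end-bound = subst (_≤ length w) (sym (+-assoc i₀ (length c) (length b)))
        (inside-suf⇒inside-w (subst (_≤ length s) (length-++ c)
          (prefix-length (r , trans (++-assoc c b r) eq))))
      open ≡-Reasoning
      same-factor : take (length b) s ≡ take (length b) (suf w (suc i₀ + length c))
      same-factor = begin
        take (length b) s                         ≡⟨ cong (take (length b)) (sym bv≡s) ⟩
        take (length b) (b ++ v)                  ≡⟨ take-length-++ b ⟩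
        b                                         ≡⟨ sym (take-length-++ b) ⟩
        take (length b) (b ++ r)                  ≡⟨ cong (take (length b)) (sym (drop-length-++ c)) ⟩
        take (length b) (drop (length c) (c ++ b ++ r))
          ≡⟨ cong (λ x → take (length b) (drop (length c) x)) eq ⟩
        take (length b) (drop (length c) s)
          ≡⟨ cong (take (length b)) (sym (suf-+ w i₀ (length c))) ⟩
        take (length b) (suf w (suc i₀ + length c)) ∎

    noRecurringPrefix : {k : ℕ} → (∀ k′ → LSFWitness w (suc i₀) k′ → k′ ≤ k) →
      NoRecurringPrefixLongerThan k (suf w (suc i₀))
    noRecurringPrefix max c []          r _    _   _  = z≤n
    noRecurringPrefix max c b@(_ ∷ _) r c≢[] b⊑s eq = max (length b)
      (suc i₀ + length c , m<m+n (suc i₀) (length-nonempty c≢[]) ,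
       occurrence-start {c} {b} {r} (λ ()) eq , occurrence⇒SameFactor {c} {b} {r} b⊑s eq)

    noOccurrenceAfter : {k d : ℕ} → 0 < k → k ≤ length (suf w (suc i₀)) →
      (∀ j′ → suc i₀ < j′ → j′ ≤ length w → SameFactor w (suc i₀) j′ k → j′ ≤ suc i₀ + d) →
      NoOccurrenceAfter d (take k (suf w (suc i₀))) (suf w (suc i₀))
    noOccurrenceAfter _   _  _    []          _ _  = z≤n
    noOccurrenceAfter {k} 0<k k≤ last c@(_ ∷ _) r eq = +-cancelˡ-≤ (suc i₀) _ _
      (last (suc i₀ + length c) (m<m+n (suc i₀) (s≤s z≤n))
        (occurrence-start {c} {r = r} f≢[] eq)
        (subst (SameFactor w (suc i₀) (suc i₀ + length c)) (length-take≤ k≤)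
          (occurrence⇒SameFactor {c} {r = r} (take-prefix k _) eq)))
      where
      f≢[] : take k (suf w (suc i₀)) ≢ []
      f≢[] = length-pos⇒≢[] (subst (0 <_) (sym (length-take≤ k≤)) 0<k)

lemma2 : {A : Set} (w : List A) (i : ℕ) → 1 ≤ i → i ≤ length w →
    (k : ℕ) → IsLSFℓ w i k → 0 < k →
    (j : ℕ) → IsLSFr w i k j →
    (u : ℕ) → IsLUF w j u → k < u →
    (v : ℕ) → IsLUF w i v →
    v ≡ j + u ∸ i
lemma2 w (suc i₀) (s≤s z≤n) i≤n k (inj₁ (_ , refl)) () j _ u _ _ v _
lemma2 w (suc i₀) (s≤s z≤n) i≤n k (inj₂ (_ , _ , maxLSF)) 0<k j
       (i<j , j≤n , (k-fits , _ , f≡fac-j) , lastOcc) u luf-j k<u v luf-i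
  with m≤n⇒∃[o]m+o≡n (<⇒≤ i<j)
... | d , refl = begin
  v                         ≡⟨ longestUnborderedPrefix-unique luf-i luf-s ⟩
  length a + u              ≡⟨ cong (_+ u) (length-take≤ d≤) ⟩
  d + u                     ≡⟨ sym (m+n∸m≡n (suc i₀) (d + u)) ⟩
  suc i₀ + (d + u) ∸ suc i₀ ≡⟨ cong (_∸ suc i₀) (sym (+-assoc (suc i₀) d u)) ⟩
  suc i₀ + d + u ∸ suc i₀   ∎
  where
  open ≡-Reasoning
  s = suf w (suc i₀)
  a = take d s
  t = drop d s
  f = take k s
  d≤ : d ≤ length s
  d≤ = inside-w⇒inside-suf w i≤n (≤-trans (n≤1+n _) j≤n)
  k≤ : k ≤ length s
  k≤ = inside-w⇒inside-suf w i≤n (≤-pred k-fits)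
  f⊑t : IsPrefix f t
  f⊑t = subst (λ x → IsPrefix x t) (sym (trans f≡fac-j (cong (take k) (suf-+ w i₀ d))))
    (take-prefix k t)
  luf-s : LongestUnborderedPrefix s (length a + u)
  luf-s = longestUnborderedPrefix-++ (take++drop≡id d s) (take-prefix k s) f⊑t
    (subst (λ m → NoRecurringPrefixLongerThan m s) (sym (length-take≤ k≤))
      (noRecurringPrefix w i≤n maxLSF))
    (subst (λ m → NoOccurrenceAfter m f s) (sym (length-take≤ d≤))
      (noOccurrenceAfter w i≤n 0<k k≤ lastOcc))
    (subst (_< u) (sym (length-take≤ k≤)) k<u)
    (subst (λ x → LongestUnborderedPrefix x u) (suf-+ w i₀ d) luf-j)
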